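{- For each positive integer $k$ there exists a $(2k+1)\times(2k+1)$ Seidel matrix of a tournament having $\pm\sqrt{4k-1}\,i$ as eigenvalues.
   Context: A tournament of order $m$ is a digraph on $\{1,\dots,m\}$ with exactly one of the arcs $ij$, $ji$ for each pair $i\ne j$. Its Seidel matrix $S=[s_{ij}]$ is the $m\times m$ skew-symmetric matrix with zero diagonal, $s_{ij}=1$ if $ij$ is an arc and $s_{ij}=-1$ otherwise. -}

module Defs where

open import Data.Nat using (ℕ; zero; suc)
open import Data.Integer as ℤ using (ℤ; +_; 0ℤ; 1ℤ; -1ℤ)
open import Data.Fin using (Fin; zero; suc; _≟_)
open import Data.Bool using (Bool; true; false; not; if_then_else_)
open import Data.Product using (Σ; _×_; _,_; ∃)
open import Relation.Nullary using (¬_)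
open import Relation.Nullary.Decidable using (⌊_⌋)
open import Relation.Binary.PropositionalEquality using (_≡_; _≢_)

record Tournament (m : ℕ) : Set where
  field
    arc    : Fin m → Fin m → Bool
    irrefl : ∀ i → arc i i ≡ false
    tour   : ∀ i j → i ≢ j → arc i j ≡ not (arc j i)
open Tournament public

seidel : ∀ {m} → Tournament m → Fin m → Fin m → ℤ
seidel T i j =
  if ⌊ i ≟ j ⌋ then 0ℤ else (if arc T i j then 1ℤ else -1ℤ)

-- The quadratic ring ℤ[√d] : elements re + im·√d  (d an integer parameter).
-- For d < 0 it embeds into ℂ via √d ↦ i·√(-d).
record ℤ√ (d : ℤ) : Set where
  constructor _+√_
  field
    re : ℤ
    im : ℤ
open ℤ√ public

module _ {d : ℤ} where
  infixl 6 _⊕_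
  infixl 7 _⊗_

  _⊕_ : ℤ√ d → ℤ√ d → ℤ√ d
  (a +√ b) ⊕ (c +√ e) = (a ℤ.+ c) +√ (b ℤ.+ e)

  _⊗_ : ℤ√ d → ℤ√ d → ℤ√ d
  (a +√ b) ⊗ (c +√ e) = (a ℤ.* c ℤ.+ d ℤ.* (b ℤ.* e)) +√ (a ℤ.* e ℤ.+ b ℤ.* c)

  ι : ℤ → ℤ√ d
  ι a = a +√ 0ℤ

  zeroQ : ℤ√ d
  zeroQ = 0ℤ +√ 0ℤ

  ΣQ : ∀ n → (Fin n → ℤ√ d) → ℤ√ d
  ΣQ zero    f = zeroQ
  ΣQ (suc n) f = f zero ⊕ ΣQ n (λ j → f (suc j))

  mulMV : ∀ {m} → (Fin m → Fin m → ℤ) → (Fin m → ℤ√ d) → Fin m → ℤ√ d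
  mulMV {m} M v i = ΣQ m (λ j → ι (M i j) ⊗ v j)

IsEigenvalue : ∀ {d m} → (Fin m → Fin m → ℤ) → ℤ√ d → Set
IsEigenvalue {d} {m} M λ' =
  Σ (Fin m → ℤ√ d) λ v → (∃ λ i → v i ≢ zeroQ) × (∀ i → mulMV M v i ≡ λ' ⊗ v i)

√+ √- : (d : ℤ) → ℤ√ d
√+ d = 0ℤ +√ 1ℤ
√- d = 0ℤ +√ -1ℤ

{-# OPTIONS --safe #-}
module Submission where

-- Let R be a regular tournament on 2k − 1 vertices and add two vertices a → b with b → R → a.
-- For w = (1, −1, 0, …, 0) and u = (−1, −1, 2, …, 2), regularity of R gives S w = u and
-- S u = d w with d = −(4k − 1), hence S (u ± √d w) = ± √d (u ± √d w).  Regular tournaments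
-- of every odd order are grown two vertices at a time.

open import Defs
open import Data.Nat using (ℕ; zero; suc; _+_; _*_; _∸_; _≤_)
open import Data.Integer as ℤ using (ℤ; 0ℤ; 1ℤ; -1ℤ; -_; +_; _-_)
import Data.Integer.Properties as ℤ
import Data.Integer.Tactic.RingSolver as ℤ-Solver
import Data.Nat.Tactic.RingSolver as ℕ-Solver
open import Data.Fin using (Fin; zero; suc; _≟_)
open import Data.Bool using (Bool; true; false; not; if_then_else_)
open import Data.Bool.Properties using (not-involutive)
open import Data.Product using (Σ; _×_; _,_; ∃)
open import Data.Vec.Functional using (_∷_; tail)
open import Data.Empty using (⊥-elim)
open import Function using (_∘_; const)
open import Relation.Nullary using (yes; no)
open import Relation.Binary.PropositionalEquality
open import Algebra.Properties.Semiring.Sum ℤ.+-*-semiring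
  using (sum; sum-cong-≗; *-distribˡ-sum; *-distribʳ-sum)
open ≡-Reasoning

_*ᵥ_ : ∀ {n} → (Fin n → Fin n → ℤ) → (Fin n → ℤ) → Fin n → ℤ
(M *ᵥ x) i = sum (λ j → M i j ℤ.* x j)

sum-const : ∀ n (x : ℤ) → sum {n} (const x) ≡ + n ℤ.* x
sum-const zero    x = refl
sum-const (suc n) x = begin
  x ℤ.+ sum {n} (const x) ≡⟨ cong (ℤ._+_ x) (sum-const n x) ⟩
  x ℤ.+ + n ℤ.* x         ≡⟨ ℤ.suc-* (+ n) x ⟨
  + suc n ℤ.* x           ∎

*ᵥ-const : ∀ {n} (M : Fin n → Fin n → ℤ) c i → (M *ᵥ const c) i ≡ sum (M i) ℤ.* c
*ᵥ-const M c i = sym (*-distribʳ-sum c (M i))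

*ᵥ-neg : ∀ {n} (M : Fin n → Fin n → ℤ) x i → (M *ᵥ (-_ ∘ x)) i ≡ - (M *ᵥ x) i
*ᵥ-neg M x i = begin
  sum (λ j → M i j ℤ.* - x j)
    ≡⟨ sum-cong-≗ (λ j → sym (trans (ℤ.-1*i≡-i _) (ℤ.neg-distribʳ-* (M i j) (x j)))) ⟩
  sum (λ j → -1ℤ ℤ.* (M i j ℤ.* x j))
    ≡⟨ *-distribˡ-sum -1ℤ (λ j → M i j ℤ.* x j) ⟨
  -1ℤ ℤ.* (M *ᵥ x) i
    ≡⟨ ℤ.-1*i≡-i _ ⟩
  - (M *ᵥ x) i
    ∎

ι-⊗ : ∀ {d} a x y → ι {d} a ⊗ (x +√ y) ≡ (a ℤ.* x) +√ (a ℤ.* y)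
ι-⊗ {d} a x y = cong₂ _+√_
  (trans (cong (ℤ._+_ (a ℤ.* x)) (ℤ.*-zeroʳ d)) (ℤ.+-identityʳ _))
  (ℤ.+-identityʳ _)

ΣQ-ι-⊗ : ∀ {d} n (a x y : Fin n → ℤ) →
  ΣQ {d} n (λ j → ι (a j) ⊗ (x j +√ y j))
    ≡ sum (λ j → a j ℤ.* x j) +√ sum (λ j → a j ℤ.* y j)
ΣQ-ι-⊗ zero    a x y = refl
ΣQ-ι-⊗ (suc n) a x y =
  cong₂ _⊕_ (ι-⊗ (a zero) (x zero) (y zero)) (ΣQ-ι-⊗ n (tail a) (tail x) (tail y))

mulMV-+√ : ∀ {d n} (M : Fin n → Fin n → ℤ) (x y : Fin n → ℤ) i →
  mulMV {d} M (λ j → x j +√ y j) i ≡ (M *ᵥ x) i +√ (M *ᵥ y) i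
mulMV-+√ {n = n} M x y i = ΣQ-ι-⊗ n (M i) x y

√+-⊗ : ∀ {d} x y → √+ d ⊗ (x +√ y) ≡ (d ℤ.* y) +√ x
√+-⊗ {d} x y = cong₂ _+√_
  (trans (ℤ.+-identityˡ _) (cong (ℤ._*_ d) (ℤ.*-identityˡ y)))
  (trans (ℤ.+-identityˡ _) (ℤ.*-identityˡ x))

√--⊗ : ∀ {d} x y → √- d ⊗ (x +√ y) ≡ (- (d ℤ.* y)) +√ (- x)
√--⊗ {d} x y = cong₂ _+√_
  (trans (ℤ.+-identityˡ _)
         (trans (cong (ℤ._*_ d) (ℤ.-1*i≡-i y)) (sym (ℤ.neg-distribʳ-* d y))))
  (trans (ℤ.+-identityˡ _) (ℤ.-1*i≡-i x))

±√-eigenvalues : ∀ {n} d (M : Fin n → Fin n → ℤ) (u w : Fin n → ℤ) →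
  (∃ λ i → w i ≢ 0ℤ) → M *ᵥ w ≗ u → M *ᵥ u ≗ (λ i → d ℤ.* w i) →
  IsEigenvalue M (√+ d) × IsEigenvalue M (√- d)
±√-eigenvalues d M u w (i , wᵢ≢0) Mw≗u Mu≗dw =
  ((λ j → u j +√ w j) , (i , wᵢ≢0 ∘ cong im) , eigen+) ,
  ((λ j → (- u j) +√ w j) , (i , wᵢ≢0 ∘ cong im) , eigen-)
  where
  eigen+ : ∀ j → mulMV M (λ j → u j +√ w j) j ≡ √+ d ⊗ (u j +√ w j)
  eigen+ j = begin
    mulMV M (λ j → u j +√ w j) j ≡⟨ mulMV-+√ M u w j ⟩
    (M *ᵥ u) j +√ (M *ᵥ w) j     ≡⟨ cong₂ _+√_ (Mu≗dw j) (Mw≗u j) ⟩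
    (d ℤ.* w j) +√ u j           ≡⟨ √+-⊗ (u j) (w j) ⟨
    √+ d ⊗ (u j +√ w j)          ∎

  eigen- : ∀ j → mulMV M (λ j → (- u j) +√ w j) j ≡ √- d ⊗ ((- u j) +√ w j)
  eigen- j = begin
    mulMV M (λ j → (- u j) +√ w j) j ≡⟨ mulMV-+√ M (-_ ∘ u) w j ⟩
    (M *ᵥ (-_ ∘ u)) j +√ (M *ᵥ w) j
      ≡⟨ cong₂ _+√_ (trans (*ᵥ-neg M u j) (cong -_ (Mu≗dw j))) (Mw≗u j) ⟩
    (- (d ℤ.* w j)) +√ u j
      ≡⟨ cong ((- (d ℤ.* w j)) +√_) (ℤ.neg-involutive (u j)) ⟨
    (- (d ℤ.* w j)) +√ (- - u j)     ≡⟨ √--⊗ (- u j) (w j) ⟨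
    √- d ⊗ ((- u j) +√ w j)          ∎

sign : Bool → ℤ
sign b = if b then 1ℤ else -1ℤ

emptyTournament : Tournament 0
emptyTournament = record { arc = λ () ; irrefl = λ () ; tour = λ () }

adjoin : ∀ {n} → (Fin n → Bool) → Tournament n → Tournament (suc n)
adjoin {n} out T = record { arc = arc′ ; irrefl = irrefl′ ; tour = tour′ }
  where
  arc′ : Fin (suc n) → Fin (suc n) → Bool
  arc′ zero    zero    = false
  arc′ zero    (suc t) = out t
  arc′ (suc s) zero    = not (out s)
  arc′ (suc s) (suc t) = arc T s t

  irrefl′ : ∀ i → arc′ i i ≡ false
  irrefl′ zero    = refl
  irrefl′ (suc s) = irrefl T s

  tour′ : ∀ i j → i ≢ j → arc′ i j ≡ not (arc′ j i)
  tour′ zero    zero    0≢0 = ⊥-elim (0≢0 refl)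
  tour′ zero    (suc t) _   = sym (not-involutive (out t))
  tour′ (suc s) zero    _   = refl
  tour′ (suc s) (suc t) s≢t = tour T s t (s≢t ∘ cong suc)

module _ {n} (out : Fin n → Bool) (T : Tournament n) where

  seidel-adjoin-suc : ∀ s t → seidel (adjoin out T) (suc s) (suc t) ≡ seidel T s t
  seidel-adjoin-suc s t with s ≟ t
  ... | yes _ = refl
  ... | no  _ = refl

  sum-seidel-adjoin-zero : sum (seidel (adjoin out T) zero) ≡ sum (sign ∘ out)
  sum-seidel-adjoin-zero = ℤ.+-identityˡ _

  sum-seidel-adjoin-suc : ∀ s →
    sum (seidel (adjoin out T) (suc s)) ≡ sign (not (out s)) ℤ.+ sum (seidel T s)
  sum-seidel-adjoin-suc s = cong (ℤ._+_ (sign (not (out s)))) (sum-cong-≗ (seidel-adjoin-suc s))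

  *ᵥ-seidel-adjoin-zero : ∀ x →
    (seidel (adjoin out T) *ᵥ x) zero ≡ sum (λ t → sign (out t) ℤ.* x (suc t))
  *ᵥ-seidel-adjoin-zero x = ℤ.+-identityˡ _

  *ᵥ-seidel-adjoin-suc : ∀ x s →
    (seidel (adjoin out T) *ᵥ x) (suc s)
      ≡ sign (not (out s)) ℤ.* x zero ℤ.+ (seidel T *ᵥ tail x) s
  *ᵥ-seidel-adjoin-suc x s =
    cong (ℤ._+_ (sign (not (out s)) ℤ.* x zero))
         (sum-cong-≗ (λ t → cong (ℤ._* x (suc t)) (seidel-adjoin-suc s t)))

-- Row sums of the Seidel matrix are outdegree minus indegree.
IsRegular : ∀ {n} → Tournament n → Set
IsRegular T = ∀ i → sum (seidel T i) ≡ 0ℤ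

pairHeads : ∀ m → Fin (m * 2 + 1) → Bool
pairHeads zero    = const false
pairHeads (suc m) = true ∷ false ∷ pairHeads m

-- The new pair x → y: x beats the m earlier heads, y the other m + 1 old vertices,
-- so every old vertex beats exactly one of x, y and both new vertices stay balanced.
regularTournament : ∀ m → Tournament (m * 2 + 1)
regularTournament zero    = adjoin (λ ()) emptyTournament
regularTournament (suc m) =
  adjoin (true ∷ pairHeads m) (adjoin (not ∘ pairHeads m) (regularTournament m))

sum-sign-pairHeads : ∀ m → sum (sign ∘ pairHeads m) ≡ -1ℤ
sum-sign-pairHeads zero    = refl
sum-sign-pairHeads (suc m) = cong (λ s → 1ℤ ℤ.+ (-1ℤ ℤ.+ s)) (sum-sign-pairHeads m)

sum-sign-not-pairHeads : ∀ m → sum (sign ∘ not ∘ pairHeads m) ≡ 1ℤ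
sum-sign-not-pairHeads zero    = refl
sum-sign-not-pairHeads (suc m) = cong (λ s → -1ℤ ℤ.+ (1ℤ ℤ.+ s)) (sum-sign-not-pairHeads m)

sign-not-+-sign-not-not : ∀ b → sign (not b) ℤ.+ sign (not (not b)) ≡ 0ℤ
sign-not-+-sign-not-not true  = refl
sign-not-+-sign-not-not false = refl

regularTournament-isRegular : ∀ m → IsRegular (regularTournament m)
regularTournament-isRegular zero    zero = refl
regularTournament-isRegular (suc m)      = rows
  where
  R : Tournament (m * 2 + 1)
  R = regularTournament m

  X : Fin (m * 2 + 1) → Bool
  X = pairHeads m

  Rʸ : Tournament (suc (m * 2 + 1))
  Rʸ = adjoin (not ∘ X) R

  rows : IsRegular (adjoin (true ∷ X) Rʸ)
  rows zero = begin
    sum (seidel (adjoin (true ∷ X) Rʸ) zero) ≡⟨ sum-seidel-adjoin-zero (true ∷ X) Rʸ ⟩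
    1ℤ ℤ.+ sum (sign ∘ X)                    ≡⟨ cong (ℤ._+_ 1ℤ) (sum-sign-pairHeads m) ⟩
    0ℤ                                       ∎
  rows (suc zero) = begin
    sum (seidel (adjoin (true ∷ X) Rʸ) (suc zero))
      ≡⟨ sum-seidel-adjoin-suc (true ∷ X) Rʸ zero ⟩
    -1ℤ ℤ.+ sum (seidel Rʸ zero)
      ≡⟨ cong (ℤ._+_ -1ℤ) (sum-seidel-adjoin-zero (not ∘ X) R) ⟩
    -1ℤ ℤ.+ sum (sign ∘ not ∘ X)
      ≡⟨ cong (ℤ._+_ -1ℤ) (sum-sign-not-pairHeads m) ⟩
    0ℤ
      ∎
  rows (suc (suc t)) = begin
    sum (seidel (adjoin (true ∷ X) Rʸ) (suc (suc t)))
      ≡⟨ sum-seidel-adjoin-suc (true ∷ X) Rʸ (suc t) ⟩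
    sign (not (X t)) ℤ.+ sum (seidel Rʸ (suc t))
      ≡⟨ cong (ℤ._+_ (sign (not (X t)))) (sum-seidel-adjoin-suc (not ∘ X) R t) ⟩
    sign (not (X t)) ℤ.+ (sign (not (not (X t))) ℤ.+ sum (seidel R t))
      ≡⟨ cong (λ z → sign (not (X t)) ℤ.+ (sign (not (not (X t))) ℤ.+ z))
              (regularTournament-isRegular m t) ⟩
    sign (not (X t)) ℤ.+ (sign (not (not (X t))) ℤ.+ 0ℤ)
      ≡⟨ cong (ℤ._+_ (sign (not (X t)))) (ℤ.+-identityʳ _) ⟩
    sign (not (X t)) ℤ.+ sign (not (not (X t)))
      ≡⟨ sign-not-+-sign-not-not (X t) ⟩
    0ℤ
      ∎

cycleExtension : ∀ {n} → Tournament n → Tournament (2 + n)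
cycleExtension R = adjoin (true ∷ const false) (adjoin (const true) R)

module _ {n} {R : Tournament n} (regular : IsRegular R) where

  private
    S : Fin (2 + n) → Fin (2 + n) → ℤ
    S = seidel (cycleExtension R)

    Rᵇ : Tournament (suc n)
    Rᵇ = adjoin (const true) R

  *ᵥ-seidel-cycleExtension : ∀ a b c →
    seidel (cycleExtension R) *ᵥ (a ∷ b ∷ const c)
      ≗ (b - + n ℤ.* c) ∷ (+ n ℤ.* c - a) ∷ const (a - b)
  *ᵥ-seidel-cycleExtension a b c zero = begin
    (S *ᵥ (a ∷ b ∷ const c)) zero
      ≡⟨ *ᵥ-seidel-adjoin-zero (true ∷ const false) Rᵇ (a ∷ b ∷ const c) ⟩
    1ℤ ℤ.* b ℤ.+ sum {n} (const (-1ℤ ℤ.* c))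
      ≡⟨ cong (ℤ._+_ (1ℤ ℤ.* b)) (sum-const n (-1ℤ ℤ.* c)) ⟩
    1ℤ ℤ.* b ℤ.+ + n ℤ.* (-1ℤ ℤ.* c)
      ≡⟨ identity b (+ n) c ⟩
    b - + n ℤ.* c
      ∎
    where
    identity : ∀ b N c → 1ℤ ℤ.* b ℤ.+ N ℤ.* (-1ℤ ℤ.* c) ≡ b - N ℤ.* c
    identity = ℤ-Solver.solve-∀
  *ᵥ-seidel-cycleExtension a b c (suc zero) = begin
    (S *ᵥ (a ∷ b ∷ const c)) (suc zero)
      ≡⟨ *ᵥ-seidel-adjoin-suc (true ∷ const false) Rᵇ (a ∷ b ∷ const c) zero ⟩
    -1ℤ ℤ.* a ℤ.+ (seidel Rᵇ *ᵥ (b ∷ const c)) zero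
      ≡⟨ cong (ℤ._+_ (-1ℤ ℤ.* a)) (*ᵥ-seidel-adjoin-zero (const true) R (b ∷ const c)) ⟩
    -1ℤ ℤ.* a ℤ.+ sum {n} (const (1ℤ ℤ.* c))
      ≡⟨ cong (ℤ._+_ (-1ℤ ℤ.* a)) (sum-const n (1ℤ ℤ.* c)) ⟩
    -1ℤ ℤ.* a ℤ.+ + n ℤ.* (1ℤ ℤ.* c)
      ≡⟨ identity a (+ n) c ⟩
    + n ℤ.* c - a
      ∎
    where
    identity : ∀ a N c → -1ℤ ℤ.* a ℤ.+ N ℤ.* (1ℤ ℤ.* c) ≡ N ℤ.* c - a
    identity = ℤ-Solver.solve-∀
  *ᵥ-seidel-cycleExtension a b c (suc (suc s)) = begin
    (S *ᵥ (a ∷ b ∷ const c)) (suc (suc s))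
      ≡⟨ *ᵥ-seidel-adjoin-suc (true ∷ const false) Rᵇ (a ∷ b ∷ const c) (suc s) ⟩
    1ℤ ℤ.* a ℤ.+ (seidel Rᵇ *ᵥ (b ∷ const c)) (suc s)
      ≡⟨ cong (ℤ._+_ (1ℤ ℤ.* a)) (*ᵥ-seidel-adjoin-suc (const true) R (b ∷ const c) s) ⟩
    1ℤ ℤ.* a ℤ.+ (-1ℤ ℤ.* b ℤ.+ (seidel R *ᵥ const c) s)
      ≡⟨ cong (λ z → 1ℤ ℤ.* a ℤ.+ (-1ℤ ℤ.* b ℤ.+ z))
              (trans (*ᵥ-const (seidel R) c s) (cong (ℤ._* c) (regular s))) ⟩
    1ℤ ℤ.* a ℤ.+ (-1ℤ ℤ.* b ℤ.+ 0ℤ)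
      ≡⟨ identity a b ⟩
    a - b
      ∎
    where
    identity : ∀ a b → 1ℤ ℤ.* a ℤ.+ (-1ℤ ℤ.* b ℤ.+ 0ℤ) ≡ a - b
    identity = ℤ-Solver.solve-∀

  cycleExtension-±√-eigenvalues :
    let d = - (+ (2 * n + 1)) in
    IsEigenvalue (seidel (cycleExtension R)) (√+ d) × IsEigenvalue (seidel (cycleExtension R)) (√- d)
  cycleExtension-±√-eigenvalues = ±√-eigenvalues d S u w (zero , λ ()) Sw≗u Su≗dw
    where
    d : ℤ
    d = - (+ (2 * n + 1))

    w u : Fin (2 + n) → ℤ
    w = 1ℤ ∷ -1ℤ ∷ const 0ℤ
    u = -1ℤ ∷ -1ℤ ∷ const (+ 2)

    d≡-1-n*2 : d ≡ -1ℤ - + n ℤ.* + 2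
    d≡-1-n*2 = begin
      - (+ (2 * n + 1))
        ≡⟨ cong -_ (trans (ℤ.pos-+ (2 * n) 1) (cong (ℤ._+ 1ℤ) (ℤ.pos-* 2 n))) ⟩
      - (+ 2 ℤ.* + n ℤ.+ 1ℤ)
        ≡⟨ identity (+ n) ⟩
      -1ℤ - + n ℤ.* + 2
        ∎
      where
      identity : ∀ N → - (+ 2 ℤ.* N ℤ.+ 1ℤ) ≡ -1ℤ - N ℤ.* + 2
      identity = ℤ-Solver.solve-∀

    Sw≗u : S *ᵥ w ≗ u
    Sw≗u i = trans (*ᵥ-seidel-cycleExtension 1ℤ -1ℤ 0ℤ i) (row i)
      where
      row : (-1ℤ - + n ℤ.* 0ℤ) ∷ (+ n ℤ.* 0ℤ - 1ℤ) ∷ const (1ℤ - -1ℤ) ≗ u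
      row zero          = cong (ℤ._-_ -1ℤ) (ℤ.*-zeroʳ (+ n))
      row (suc zero)    = cong (λ z → z - 1ℤ) (ℤ.*-zeroʳ (+ n))
      row (suc (suc _)) = refl

    Su≗dw : S *ᵥ u ≗ (λ i → d ℤ.* w i)
    Su≗dw i = trans (*ᵥ-seidel-cycleExtension -1ℤ -1ℤ (+ 2) i) (row i)
      where
      identity : ∀ N → N ℤ.* + 2 - -1ℤ ≡ (-1ℤ - N ℤ.* + 2) ℤ.* -1ℤ
      identity = ℤ-Solver.solve-∀

      row : (-1ℤ - + n ℤ.* + 2) ∷ (+ n ℤ.* + 2 - -1ℤ) ∷ const (-1ℤ - -1ℤ)
              ≗ (λ i → d ℤ.* w i)
      row zero          = sym (trans (ℤ.*-identityʳ d) d≡-1-n*2)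
      row (suc zero)    = trans (identity (+ n)) (cong (ℤ._* -1ℤ) (sym d≡-1-n*2))
      row (suc (suc _)) = sym (ℤ.*-zeroʳ d)

2+[2m+1]≡2[1+m]+1 : ∀ m → 2 + (m * 2 + 1) ≡ 2 * suc m + 1
2+[2m+1]≡2[1+m]+1 = ℕ-Solver.solve-∀

-- 4 * suc m ∸ 1 reduces to m + 3 * suc m, which the solver (knowing no ∸) can handle.
2[2m+1]+1≡4[1+m]∸1 : ∀ m → 2 * (m * 2 + 1) + 1 ≡ 4 * suc m ∸ 1
2[2m+1]+1≡4[1+m]∸1 = identity
  where
  identity : ∀ m → 2 * (m * 2 + 1) + 1 ≡ m + 3 * suc m
  identity = ℕ-Solver.solve-∀

theorem7p6 : (k : ℕ) → 1 ≤ k →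
    Σ (Tournament (2 * k + 1)) λ T →
      IsEigenvalue (seidel T) (√+ (- (+ (4 * k ∸ 1))))
        × IsEigenvalue (seidel T) (√- (- (+ (4 * k ∸ 1))))
theorem7p6 (suc m) _ =
  subst₂ Witness (2+[2m+1]≡2[1+m]+1 m) (cong (-_ ∘ +_) (2[2m+1]+1≡4[1+m]∸1 m))
    (cycleExtension R , cycleExtension-±√-eigenvalues (regularTournament-isRegular m))
  where
  R : Tournament (m * 2 + 1)
  R = regularTournament m

  Witness : ℕ → ℤ → Set
  Witness n d = Σ (Tournament n) λ T → IsEigenvalue (seidel T) (√+ d) × IsEigenvalue (seidel T) (√- d)
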